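{- Let $n,k\in\mathbb{Z}^+$ with $k$ even such that $p=nk+1$ is prime, and suppose $p>n^4+5$. Let $g$ be a primitive root modulo $p$ and $X_i=\{g^{an+i}: a=0,\ldots,k-1\}\subseteq\mathbb{F}_p$ for $i=0,\ldots,n-1$. Then every diversity atom of the Comer algebra $C(p,n)$ is flexible; equivalently, $(X_i+X_j)\cap X_\ell\neq\emptyset$ for all $i,j,\ell\in\{0,\ldots,n-1\}$.
   Context: The Comer algebra $C(p,n)$ is the (integral, symmetric) relation algebra of binary relations on $\mathbb{F}_p$ whose atoms are the identity $\{(x,x)\}$ and $A_i=\{(x,y)\in\mathbb{F}_p^2 : x-y\in X_i\}$, $i=0,\ldots,n-1$; here $A_i\circ A_j\cap A_\ell\ne\emptyset$ iff $(X_i+X_j)\cap X_\ell\neq\emptyset$. A diversity atom $a$ is flexible if for all diversity atoms $b,c$ the cycle $abc$ is allowed, i.e. $a\le b;c$. Sums of sets are Minkowski sums. -}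

module Defs where

open import Data.Nat using (ℕ; zero; suc; _+_; _*_; _∸_; _^_; _≤_; _<_; NonZero)
open import Data.Nat.DivMod using (_%_)
open import Data.Fin using (Fin; toℕ)
open import Data.Product using (Σ; ∃; ∃-syntax; _×_)
open import Relation.Nullary using (¬_)
open import Relation.Binary.PropositionalEquality using (_≡_; _≢_)

-- Elements of 𝔽_p are represented by natural numbers x < p (canonical residues).

PrimitiveRoot : (p : ℕ) .{{_ : NonZero p}} → ℕ → Set
PrimitiveRoot p g = (g % p ≢ 0) × (∀ m → 1 ≤ m → m < p ∸ 1 → (g ^ m) % p ≢ 1)

InX : (p n k g : ℕ) .{{_ : NonZero p}} → ℕ → ℕ → Set
InX p n k g i x = ∃[ a ] (a < k × x % p ≡ (g ^ (a * n + i)) % p)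

-- The diversity atom A_i = { (x,y) ∈ 𝔽_p² : x - y ∈ X_i } of C(p,n).
Atom : (p n k g : ℕ) .{{_ : NonZero p}} → Fin n → ℕ → ℕ → Set
Atom p n k g i x y = x < p × y < p × InX p n k g (toℕ i) ((x + (p ∸ y)) % p)

-- a ≤ b ; c  for atoms a, b, c (relational inclusion into the relative product).
AtomLeqComp : (p n k g : ℕ) .{{_ : NonZero p}} → Fin n → Fin n → Fin n → Set
AtomLeqComp p n k g a b c =
  ∀ x z → Atom p n k g a x z → ∃[ y ] (Atom p n k g b x y × Atom p n k g c y z)

Flexible : (p n k g : ℕ) .{{_ : NonZero p}} → Fin n → Set
Flexible p n k g a = ∀ b c → AtomLeqComp p n k g a b c

module Submission where

-- Fix w ≢ 0 and put each u ∉ {0, w} of 𝔽_p into the cell (class of u, class of w - u),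
-- one of n² cells. If distinct u, v share a cell then v = α u and w - v = β (w - u) with
-- α ≠ β in the subgroup ⟨gⁿ⟩ of order k, and (α, β) determines (u, v); so at most
-- k(k - 1) ordered pairs of distinct points share a cell. Were some cell empty,
-- Cauchy–Schwarz over the other n² - 1 cells would give
-- (nk - 1)² ≤ (n² - 1)(nk - 1 + k(k - 1)), which fails for nk > n⁴ + 4. So every
-- w ∈ X_l is u + (w - u) with u ∈ X_i, w - u ∈ X_j, and taking w = x - z gives the
-- y = x - u witnessing flexibility.

open import Data.Nat as ℕ using (ℕ; suc; NonZero)
open import Data.Nat.Primality using (Prime)
open import Defs
open import Relation.Binary.PropositionalEquality using (_≢_)

module FiniteSums where

  open import Data.Nat
  open import Data.Nat.Properties
  open import Data.Nat.Tactic.RingSolver using (solve-∀)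
  open import Data.Product using (∃-syntax; _×_; _,_; proj₁; proj₂)
  open import Data.Sum using (inj₁; inj₂)
  open import Function using (_∘_)
  open import Relation.Nullary using (Dec; yes; no; contradiction)
  open import Relation.Binary.PropositionalEquality

  sum< : ℕ → (ℕ → ℕ) → ℕ
  sum< zero    f = 0
  sum< (suc m) f = sum< m f + f m

  syntax sum< m (λ i → e) = ∑[ i < m ] e

  𝕀 : ∀ {A : Set} → Dec A → ℕ
  𝕀 (yes _) = 1
  𝕀 (no _)  = 0

  𝕀≤1 : ∀ {A : Set} (a? : Dec A) → 𝕀 a? ≤ 1
  𝕀≤1 (yes _) = ≤-refl
  𝕀≤1 (no _)  = z≤n

  𝕀>0⇒ : ∀ {A : Set} (a? : Dec A) → 0 < 𝕀 a? → A
  𝕀>0⇒ (yes a) _ = a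

  δ : ℕ → ℕ → ℕ
  δ i j = 𝕀 (i ≟ j)

  δ≤1 : ∀ i j → δ i j ≤ 1
  δ≤1 i j = 𝕀≤1 (i ≟ j)

  δ>0⇒≡ : ∀ {i j} → 0 < δ i j → i ≡ j
  δ>0⇒≡ {i} {j} = 𝕀>0⇒ (i ≟ j)

  δ-refl : ∀ i → δ i i ≡ 1
  δ-refl i with i ≟ i
  ... | yes _  = refl
  ... | no i≢i = contradiction refl i≢i

  δ-≢ : ∀ {i j} → i ≢ j → δ i j ≡ 0
  δ-≢ {i} {j} i≢j with i ≟ j
  ... | yes i≡j = contradiction i≡j i≢j
  ... | no _    = refl

  δ-comm : ∀ i j → δ i j ≡ δ j i
  δ-comm i j with i ≟ j
  ... | yes refl = sym (δ-refl i)
  ... | no i≢j   = sym (δ-≢ (i≢j ∘ sym))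

  sgn : ℕ → ℕ
  sgn zero    = 0
  sgn (suc _) = 1

  sgn≤1 : ∀ x → sgn x ≤ 1
  sgn≤1 zero    = z≤n
  sgn≤1 (suc _) = ≤-refl

  m*n>0⇒m>0×n>0 : ∀ m n → 0 < m * n → 0 < m × 0 < n
  m*n>0⇒m>0×n>0 (suc m) (suc n) _   = z<s , z<s
  m*n>0⇒m>0×n>0 (suc m) zero    m*0>0 = contradiction (subst (0 <_) (*-zeroʳ m) m*0>0) (<-irrefl refl)

  ∑-cong : ∀ m {f g : ℕ → ℕ} → (∀ i → i < m → f i ≡ g i) → ∑[ i < m ] f i ≡ ∑[ i < m ] g i
  ∑-cong zero    f≡g = refl
  ∑-cong (suc m) f≡g = cong₂ _+_ (∑-cong m (λ i i<m → f≡g i (m<n⇒m<1+n i<m))) (f≡g m ≤-refl)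

  ∑-mono-≤ : ∀ m {f g : ℕ → ℕ} → (∀ i → i < m → f i ≤ g i) → ∑[ i < m ] f i ≤ ∑[ i < m ] g i
  ∑-mono-≤ zero    f≤g = z≤n
  ∑-mono-≤ (suc m) f≤g = +-mono-≤ (∑-mono-≤ m (λ i i<m → f≤g i (m<n⇒m<1+n i<m))) (f≤g m ≤-refl)

  ∑-distrib-+ : ∀ m (f g : ℕ → ℕ) → ∑[ i < m ] (f i + g i) ≡ ∑[ i < m ] f i + ∑[ i < m ] g i
  ∑-distrib-+ zero    f g = refl
  ∑-distrib-+ (suc m) f g rewrite ∑-distrib-+ m f g = interchange (∑[ i < m ] f i) _ (f m) (g m)
    where
    interchange : ∀ a b c d → a + b + (c + d) ≡ a + c + (b + d)
    interchange = solve-∀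

  *-distribˡ-∑ : ∀ m c (f : ℕ → ℕ) → c * ∑[ i < m ] f i ≡ ∑[ i < m ] (c * f i)
  *-distribˡ-∑ zero    c f = *-zeroʳ c
  *-distribˡ-∑ (suc m) c f rewrite sym (*-distribˡ-∑ m c f) = *-distribˡ-+ c (∑[ i < m ] f i) (f m)

  *-distribʳ-∑ : ∀ m c (f : ℕ → ℕ) → (∑[ i < m ] f i) * c ≡ ∑[ i < m ] (f i * c)
  *-distribʳ-∑ m c f = begin
    (∑[ i < m ] f i) * c  ≡⟨ *-comm _ c ⟩
    c * ∑[ i < m ] f i    ≡⟨ *-distribˡ-∑ m c f ⟩
    ∑[ i < m ] (c * f i)  ≡⟨ ∑-cong m (λ i _ → *-comm c (f i)) ⟩
    ∑[ i < m ] (f i * c)  ∎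
    where open ≡-Reasoning

  ∑-const : ∀ m c → ∑[ i < m ] c ≡ m * c
  ∑-const zero    c = refl
  ∑-const (suc m) c rewrite ∑-const m c = +-comm (m * c) c

  ∑-zero : ∀ m {f : ℕ → ℕ} → (∀ i → i < m → f i ≡ 0) → ∑[ i < m ] f i ≡ 0
  ∑-zero m f≡0 = trans (∑-cong m f≡0) (trans (∑-const m 0) (*-zeroʳ m))

  ∑-comm : ∀ m l (f : ℕ → ℕ → ℕ) → ∑[ i < m ] ∑[ j < l ] f i j ≡ ∑[ j < l ] ∑[ i < m ] f i j
  ∑-comm zero    l f = sym (∑-zero l (λ _ _ → refl))
  ∑-comm (suc m) l f rewrite ∑-comm m l f = sym (∑-distrib-+ l (λ j → ∑[ i < m ] f i j) (f m))

  ∑-δ-sift : ∀ m a (f : ℕ → ℕ) → a < m → ∑[ i < m ] (δ i a * f i) ≡ f a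
  ∑-δ-sift (suc m) a f a<1+m with m ≟ a
  ... | yes refl = trans (cong (_+ (f m + 0)) (∑-zero m below)) (+-identityʳ (f m))
    where
    below : ∀ i → i < m → δ i m * f i ≡ 0
    below i i<m rewrite δ-≢ (<⇒≢ i<m) = refl
  ... | no m≢a = trans (+-identityʳ _) (∑-δ-sift m a f (≤∧≢⇒< (≤-pred a<1+m) (m≢a ∘ sym)))

  ∑-δ : ∀ m a → a < m → ∑[ i < m ] δ i a ≡ 1
  ∑-δ m a a<m = trans (∑-cong m (λ i _ → sym (*-identityʳ (δ i a)))) (∑-δ-sift m a (λ _ → 1) a<m)

  ∑>0⇒∃ : ∀ m (f : ℕ → ℕ) → 0 < ∑[ i < m ] f i → ∃[ i ] (i < m × 0 < f i)
  ∑>0⇒∃ (suc m) f ∑>0 with f m in fm≡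
  ... | suc _ = m , ≤-refl , subst (0 <_) (sym fm≡) z<s
  ... | zero with ∑>0⇒∃ m f (subst (0 <_) (+-identityʳ _) ∑>0)
  ...   | i , i<m , fi>0 = i , m<n⇒m<1+n i<m , fi>0

  ∑-≤1 : ∀ m (f : ℕ → ℕ) → (∀ i → i < m → f i ≤ 1)
       → (∀ i j → i < m → j < m → 0 < f i → 0 < f j → i ≡ j) → ∑[ i < m ] f i ≤ 1
  ∑-≤1 zero    f f≤1 unique = z≤n
  ∑-≤1 (suc m) f f≤1 unique with f m in fm≡
  ... | zero = subst (_≤ 1) (sym (+-identityʳ _))
                 (∑-≤1 m f (λ i i<m → f≤1 i (m<n⇒m<1+n i<m))
                   (λ i j i<m j<m → unique i j (m<n⇒m<1+n i<m) (m<n⇒m<1+n j<m)))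
  ... | suc _ = subst (_≤ 1) (cong (_+ suc _) (sym rest≡0)) (subst (_≤ 1) fm≡ (f≤1 m ≤-refl))
    where
    rest≡0 : ∑[ i < m ] f i ≡ 0
    rest≡0 = ∑-zero m vanish
      where
      vanish : ∀ i → i < m → f i ≡ 0
      vanish i i<m with f i in fi≡
      ... | zero  = refl
      ... | suc _ = contradiction
                      (unique i m (m<n⇒m<1+n i<m) ≤-refl (subst (0 <_) (sym fi≡) z<s) (subst (0 <_) (sym fm≡) z<s))
                      (<⇒≢ i<m)

  ∑∑-≤1 : ∀ m₁ m₂ (f : ℕ → ℕ → ℕ) → (∀ u v → u < m₁ → v < m₂ → f u v ≤ 1)
        → (∀ u v u′ v′ → u < m₁ → v < m₂ → u′ < m₁ → v′ < m₂ → 0 < f u v → 0 < f u′ v′ → u ≡ u′ × v ≡ v′)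
        → ∑[ u < m₁ ] ∑[ v < m₂ ] f u v ≤ 1
  ∑∑-≤1 m₁ m₂ f f≤1 unique = ∑-≤1 m₁ (λ u → ∑[ v < m₂ ] f u v) row≤1 rowUnique
    where
    row≤1 : ∀ u → u < m₁ → ∑[ v < m₂ ] f u v ≤ 1
    row≤1 u u<m₁ = ∑-≤1 m₂ (f u) (λ v v<m₂ → f≤1 u v u<m₁ v<m₂)
                     (λ v v′ v<m₂ v′<m₂ p p′ → proj₂ (unique u v u v′ u<m₁ v<m₂ u<m₁ v′<m₂ p p′))
    rowUnique : ∀ u u′ → u < m₁ → u′ < m₁ → 0 < ∑[ v < m₂ ] f u v → 0 < ∑[ v < m₂ ] f u′ v → u ≡ u′
    rowUnique u u′ u<m₁ u′<m₁ p p′ with ∑>0⇒∃ m₂ (f u) p | ∑>0⇒∃ m₂ (f u′) p′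
    ... | v , v<m₂ , q | v′ , v′<m₂ , q′ = proj₁ (unique u v u′ v′ u<m₁ v<m₂ u′<m₁ v′<m₂ q q′)

  ∑-avoiding-two : ∀ m a b (f : ℕ → ℕ) → a < m → b < m
                 → ∑[ i < m ] (f i + (δ i a + δ i b)) ≡ ∑[ i < m ] f i + 2
  ∑-avoiding-two m a b f a<m b<m = begin
    ∑[ i < m ] (f i + (δ i a + δ i b))                      ≡⟨ ∑-distrib-+ m f _ ⟩
    ∑[ i < m ] f i + ∑[ i < m ] (δ i a + δ i b)             ≡⟨ cong (∑[ i < m ] f i +_) (∑-distrib-+ m _ _) ⟩
    ∑[ i < m ] f i + (∑[ i < m ] δ i a + ∑[ i < m ] δ i b)  ≡⟨ cong₂ (λ x y → ∑[ i < m ] f i + (x + y)) (∑-δ m a a<m) (∑-δ m b b<m) ⟩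
    ∑[ i < m ] f i + 2                                      ∎
    where open ≡-Reasoning

  2m[m+d]≤m²+[m+d]² : ∀ m d → 2 * m * (m + d) ≤ m * m + (m + d) * (m + d)
  2m[m+d]≤m²+[m+d]² m d = subst (2 * m * (m + d) ≤_) (square m d) (m≤m+n _ (d * d))
    where
    square : ∀ m d → 2 * m * (m + d) + d * d ≡ m * m + (m + d) * (m + d)
    square = solve-∀

  2mn≤m²+n² : ∀ m n → 2 * m * n ≤ m * m + n * n
  2mn≤m²+n² m n with ≤-total m n
  ... | inj₁ m≤n = subst (λ n → 2 * m * n ≤ m * m + n * n) (m+[n∸m]≡n m≤n) (2m[m+d]≤m²+[m+d]² m (n ∸ m))
  ... | inj₂ n≤m = subst (λ m → 2 * m * n ≤ m * m + n * n) (m+[n∸m]≡n n≤m)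
                     (subst₂ _≤_ (swap n (m ∸ n)) (+-comm (n * n) _) (2m[m+d]≤m²+[m+d]² n (m ∸ n)))
    where
    swap : ∀ n d → 2 * n * (n + d) ≡ 2 * (n + d) * n
    swap = solve-∀

  2a∑x≤∑x²+|supp|a² : ∀ m a (x : ℕ → ℕ)
    → 2 * a * ∑[ i < m ] x i ≤ ∑[ i < m ] (x i * x i) + ∑[ i < m ] sgn (x i) * (a * a)
  2a∑x≤∑x²+|supp|a² m a x = begin
    2 * a * ∑[ i < m ] x i                                          ≡⟨ *-distribˡ-∑ m (2 * a) x ⟩
    ∑[ i < m ] (2 * a * x i)                                        ≤⟨ ∑-mono-≤ m (λ i _ → termwise (x i)) ⟩
    ∑[ i < m ] (x i * x i + sgn (x i) * (a * a))                    ≡⟨ ∑-distrib-+ m _ _ ⟩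
    ∑[ i < m ] (x i * x i) + ∑[ i < m ] (sgn (x i) * (a * a))       ≡⟨ cong (∑[ i < m ] (x i * x i) +_) (sym (*-distribʳ-∑ m (a * a) (sgn ∘ x))) ⟩
    ∑[ i < m ] (x i * x i) + ∑[ i < m ] sgn (x i) * (a * a)         ∎
    where
    open ≤-Reasoning
    termwise : ∀ y → 2 * a * y ≤ y * y + sgn y * (a * a)
    termwise zero    = ≤-reflexive (*-zeroʳ (2 * a))
    termwise (suc y) = subst (2 * a * suc y ≤_) (reorder (suc y) a) (2mn≤m²+n² a (suc y))
      where
      reorder : ∀ y a → a * a + y * y ≡ y * y + 1 * (a * a)
      reorder = solve-∀

  cauchy-schwarz : ∀ m (x : ℕ → ℕ)
    → (∑[ i < m ] x i) * (∑[ i < m ] x i) ≤ (∑[ i < m ] sgn (x i)) * ∑[ i < m ] (x i * x i)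
  cauchy-schwarz zero    x = z≤n
  cauchy-schwarz (suc m) x with x m in xm≡
  ... | zero = subst₂ _≤_ (sym (dropZero² S)) (sym (dropZero* Z Q)) (cauchy-schwarz m x)
    where
    S = ∑[ i < m ] x i
    Z = ∑[ i < m ] sgn (x i)
    Q = ∑[ i < m ] (x i * x i)
    dropZero² : ∀ s → (s + 0) * (s + 0) ≡ s * s
    dropZero² = solve-∀
    dropZero* : ∀ z q → (z + 0) * (q + 0) ≡ z * q
    dropZero* = solve-∀
  ... | suc y = begin
    (S + a) * (S + a)                  ≡⟨ expand S a ⟩
    S * S + 2 * a * S + a * a          ≤⟨ +-monoˡ-≤ (a * a) (+-mono-≤ (cauchy-schwarz m x) cross) ⟩
    Z * Q + (Q + Z * (a * a)) + a * a  ≡⟨ collect Z Q a ⟩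
    (Z + 1) * (Q + a * a)              ∎
    where
    open ≤-Reasoning
    a = suc y
    S = ∑[ i < m ] x i
    Z = ∑[ i < m ] sgn (x i)
    Q = ∑[ i < m ] (x i * x i)
    cross : 2 * a * S ≤ Q + Z * (a * a)
    cross = subst (λ t → 2 * t * S ≤ Q + Z * (t * t)) xm≡ (2a∑x≤∑x²+|supp|a² m (x m) x)
    expand : ∀ s a → (s + a) * (s + a) ≡ s * s + 2 * a * s + a * a
    expand = solve-∀
    collect : ∀ z q a → z * q + (q + z * (a * a)) + a * a ≡ (z + 1) * (q + a * a)
    collect = solve-∀

  ∑+1≤ : ∀ m c (f : ℕ → ℕ) → c < m → (∀ i → f i + δ i c ≤ 1) → ∑[ i < m ] f i + 1 ≤ m
  ∑+1≤ m c f c<m f+δ≤1 = begin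
    ∑[ i < m ] f i + 1                   ≡⟨ cong (∑[ i < m ] f i +_) (∑-δ m c c<m) ⟨
    ∑[ i < m ] f i + ∑[ i < m ] δ i c    ≡⟨ ∑-distrib-+ m f (λ i → δ i c) ⟨
    ∑[ i < m ] (f i + δ i c)             ≤⟨ ∑-mono-≤ m (λ i _ → f+δ≤1 i) ⟩
    ∑[ i < m ] 1                         ≡⟨ trans (∑-const m 1) (*-identityʳ m) ⟩
    m                                    ∎
    where open ≤-Reasoning

  |supp|<m : ∀ m (x : ℕ → ℕ) c → c < m → x c ≡ 0 → ∑[ i < m ] sgn (x i) + 1 ≤ m
  |supp|<m m x c c<m xc≡0 = ∑+1≤ m c (sgn ∘ x) c<m atMostOne
    where
    atMostOne : ∀ i → sgn (x i) + δ i c ≤ 1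
    atMostOne i with i ≟ c
    ... | yes refl rewrite xc≡0 = ≤-refl
    ... | no _ = subst (_≤ 1) (sym (+-identityʳ _)) (sgn≤1 (x i))

  ∑-δ-expand : ∀ l t x → t < l → ∑[ a < l ] (δ t a * x) ≡ x
  ∑-δ-expand l t x t<l = begin
    ∑[ a < l ] (δ t a * x)   ≡⟨ sym (*-distribʳ-∑ l x (δ t)) ⟩
    (∑[ a < l ] δ t a) * x   ≡⟨ cong (_* x) (trans (∑-cong l (λ a _ → δ-comm t a)) (∑-δ l t t<l)) ⟩
    1 * x                    ≡⟨ *-identityˡ x ⟩
    x                        ∎
    where open ≡-Reasoning

  ∑²-comm-∑² : ∀ m₁ m₂ l₁ l₂ (F : ℕ → ℕ → ℕ → ℕ → ℕ)
    → ∑[ u < m₁ ] ∑[ v < m₂ ] ∑[ a < l₁ ] ∑[ b < l₂ ] F u v a b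
    ≡ ∑[ a < l₁ ] ∑[ b < l₂ ] ∑[ u < m₁ ] ∑[ v < m₂ ] F u v a b
  ∑²-comm-∑² m₁ m₂ l₁ l₂ F = begin
    ∑[ u < m₁ ] ∑[ v < m₂ ] ∑[ a < l₁ ] ∑[ b < l₂ ] F u v a b  ≡⟨ ∑-cong m₁ (λ u _ → ∑-comm m₂ l₁ _) ⟩
    ∑[ u < m₁ ] ∑[ a < l₁ ] ∑[ v < m₂ ] ∑[ b < l₂ ] F u v a b  ≡⟨ ∑-comm m₁ l₁ _ ⟩
    ∑[ a < l₁ ] ∑[ u < m₁ ] ∑[ v < m₂ ] ∑[ b < l₂ ] F u v a b  ≡⟨ ∑-cong l₁ (λ a _ → ∑-cong m₁ (λ u _ → ∑-comm m₂ l₂ _)) ⟩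
    ∑[ a < l₁ ] ∑[ u < m₁ ] ∑[ b < l₂ ] ∑[ v < m₂ ] F u v a b  ≡⟨ ∑-cong l₁ (λ a _ → ∑-comm m₁ l₂ _) ⟩
    ∑[ a < l₁ ] ∑[ b < l₂ ] ∑[ u < m₁ ] ∑[ v < m₂ ] F u v a b  ∎
    where open ≡-Reasoning

  ∑∑-offDiagonal-injection-≤ : ∀ m₁ m₂ l (f τ σ : ℕ → ℕ → ℕ)
    → (∀ u v → τ u v < l) → (∀ u v → σ u v < l)
    → (∀ u v → u < m₁ → v < m₂ → f u v ≤ 1)
    → (∀ u v → u < m₁ → v < m₂ → 0 < f u v → τ u v ≢ σ u v)
    → (∀ u v u′ v′ → u < m₁ → v < m₂ → u′ < m₁ → v′ < m₂ → 0 < f u v → 0 < f u′ v′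
         → τ u v ≡ τ u′ v′ → σ u v ≡ σ u′ v′ → u ≡ u′ × v ≡ v′)
    → ∑[ u < m₁ ] ∑[ v < m₂ ] f u v ≤ l * (l ∸ 1)
  ∑∑-offDiagonal-injection-≤ m₁ m₂ l f τ σ τ<l σ<l f≤1 τ≢σ injective = begin
    ∑[ u < m₁ ] ∑[ v < m₂ ] f u v                ≡⟨ ∑-cong m₁ (λ u _ → ∑-cong m₂ (λ v _ → sym (expand u v))) ⟩
    ∑[ u < m₁ ] ∑[ v < m₂ ] ∑[ a < l ] ∑[ b < l ] F u v a b  ≡⟨ ∑²-comm-∑² m₁ m₂ l l F ⟩
    ∑[ a < l ] ∑[ b < l ] fibre a b              ≤⟨ ∑-mono-≤ l row≤ ⟩
    ∑[ a < l ] (l ∸ 1)                           ≡⟨ ∑-const l (l ∸ 1) ⟩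
    l * (l ∸ 1)                                  ∎
    where
    open ≤-Reasoning
    F : ℕ → ℕ → ℕ → ℕ → ℕ
    F u v a b = δ (τ u v) a * (δ (σ u v) b * f u v)
    fibre : ℕ → ℕ → ℕ
    fibre a b = ∑[ u < m₁ ] ∑[ v < m₂ ] F u v a b

    expand : ∀ u v → ∑[ a < l ] ∑[ b < l ] F u v a b ≡ f u v
    expand u v = trans (∑-cong l (λ a _ → trans (sym (*-distribˡ-∑ l (δ (τ u v) a) _))
                                                (cong (δ (τ u v) a *_) (∑-δ-expand l (σ u v) (f u v) (σ<l u v)))))
                       (∑-δ-expand l (τ u v) (f u v) (τ<l u v))

    F>0 : ∀ {u v a b} → 0 < F u v a b → τ u v ≡ a × σ u v ≡ b × 0 < f u v
    F>0 {u} {v} {a} {b} F>0 with m*n>0⇒m>0×n>0 (δ (τ u v) a) _ F>0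
    ... | τa , rest with m*n>0⇒m>0×n>0 (δ (σ u v) b) (f u v) rest
    ...   | σb , f>0 = δ>0⇒≡ τa , δ>0⇒≡ σb , f>0

    fibre≤1 : ∀ a b → fibre a b ≤ 1
    fibre≤1 a b = ∑∑-≤1 m₁ m₂ (λ u v → F u v a b)
      (λ u v u<m₁ v<m₂ → *-mono-≤ (δ≤1 (τ u v) a) (*-mono-≤ (δ≤1 (σ u v) b) (f≤1 u v u<m₁ v<m₂)))
      (λ u v u′ v′ u<m₁ v<m₂ u′<m₁ v′<m₂ p p′ → let (τa , σb , f>0) = F>0 p ; (τ′a , σ′b , f′>0) = F>0 p′ in
        injective u v u′ v′ u<m₁ v<m₂ u′<m₁ v′<m₂ f>0 f′>0 (trans τa (sym τ′a)) (trans σb (sym σ′b)))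

    diagonal : ∀ a → fibre a a ≡ 0
    diagonal a = ∑-zero m₁ (λ u u<m₁ → ∑-zero m₂ (λ v v<m₂ → vanish u v u<m₁ v<m₂))
      where
      vanish : ∀ u v → u < m₁ → v < m₂ → F u v a a ≡ 0
      vanish u v u<m₁ v<m₂ with F u v a a in F≡
      ... | zero  = refl
      ... | suc _ = let (τa , σa , f>0) = F>0 (subst (0 <_) (sym F≡) z<s) in
                    contradiction (trans τa (sym σa)) (τ≢σ u v u<m₁ v<m₂ f>0)

    row≤ : ∀ a → a < l → ∑[ b < l ] fibre a b ≤ l ∸ 1
    row≤ a a<l = m+n≤o⇒m≤o∸n _ (∑+1≤ l a (fibre a) a<l atMostOne)
      where
      atMostOne : ∀ b → fibre a b + δ b a ≤ 1
      atMostOne b with b ≟ a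
      ... | yes refl rewrite diagonal b = ≤-refl
      ... | no _ = subst (_≤ 1) (sym (+-identityʳ _)) (fibre≤1 a b)

  ∑*∑ : ∀ m₁ m₂ (f g : ℕ → ℕ) → (∑[ u < m₁ ] f u) * (∑[ v < m₂ ] g v) ≡ ∑[ u < m₁ ] ∑[ v < m₂ ] (f u * g v)
  ∑*∑ m₁ m₂ f g = trans (*-distribʳ-∑ m₁ _ f) (∑-cong m₁ (λ u _ → *-distribˡ-∑ m₂ (f u) g))

module Arithmetic where

  open import Data.Nat
  open import Data.Nat.Properties
  open import Data.Nat.DivMod using (_%_; [m+kn]%n≡m%n; m<n⇒m%n≡m)
  open import Data.Nat.Tactic.RingSolver using (solve-∀)
  open import Data.Product using (_×_; _,_)
  open import Relation.Nullary using (yes; no; contradiction)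
  open import Relation.Binary.PropositionalEquality

  -- M = nk - 1 points in Z ≤ n² - 1 cells make at least M²/Z same-cell pairs by
  -- Cauchy–Schwarz; once k ≥ n³ this exceeds M + k(k - 1).
  square-exceeds-pair-bound : ∀ n k M Z → M + 2 ≡ suc (n * k) → Z + 1 ≤ n * n
    → n ^ 4 + 5 < suc (n * k) → Z * (M + k * (k ∸ 1)) < M * M
  square-exceeds-pair-bound zero    _ _ _ _ _ (s≤s ())
  square-exceeds-pair-bound (suc a) zero M Z _ _ big =
    contradiction (≤-trans (s≤s z≤n) (m≤n+m 5 (suc a ^ 4))) (<⇒≱ (subst (suc a ^ 4 + 5 <_) (cong suc (*-zeroʳ a)) big))
  square-exceeds-pair-bound (suc a) (suc b) M Z M+2≡p Z<n² big = begin-strict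
    Z * (M + suc b * b)            ≤⟨ *-monoˡ-≤ _ Z≤n²-1 ⟩
    (a + a * n) * (M + suc b * b)  <⟨ excess′ ⟩
    M * M                          ∎
    where
    open ≤-Reasoning
    n = suc a
    M≡ : M ≡ b + a * suc b
    M≡ = +-cancelʳ-≡ 2 M _ (trans M+2≡p (shift a b))
      where
      shift : ∀ a b → suc (suc a * suc b) ≡ b + a * suc b + 2
      shift = solve-∀
    Z≤n²-1 : Z ≤ a + a * n
    Z≤n²-1 = ≤-pred (subst (_≤ n * n) (+-comm Z 1) Z<n²)
    n³≤b : n * (n * n) ≤ b
    n³≤b with n * (n * n) ≤? b
    ... | yes n³≤b = n³≤b
    ... | no n³≰b = contradiction big (≤⇒≯ (begin
      suc (n * suc b)      ≤⟨ s≤s (*-monoʳ-≤ n (≰⇒> n³≰b)) ⟩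
      suc (n * (n * (n * n))) ≡⟨ cong suc (sym (n⁴ n)) ⟩
      suc (n ^ 4)          ≡⟨ +-comm 1 (n ^ 4) ⟩
      n ^ 4 + 1            ≤⟨ +-monoʳ-≤ (n ^ 4) (s≤s z≤n) ⟩
      n ^ 4 + 5            ∎))
      where
      open ≤-Reasoning
      n⁴ : ∀ n → n ^ 4 ≡ n * (n * (n * n))
      n⁴ n = cong (λ x → n * (n * (n * x))) (*-identityʳ n)
    excess′ : (a + a * n) * (M + suc b * b) < M * M
    excess′ rewrite M≡ | sym (m+[n∸m]≡n n³≤b) = excess a (b ∸ n * (n * n))
      where
      -- With n = a + 1 and k = n³ + t + 1, M² − (n² − 1)(M + k(k − 1)) is a polynomial
      -- in a and t with nonnegative coefficients and constant term 1.
      excess : ∀ a t → let n = suc a ; b = n * (n * n) + t ; M = b + a * suc b in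
               (a + a * n) * (M + suc b * b) < M * M
      excess a t = subst (pairBound <_) (sym (identity a t)) (m<m+n pairBound z<s)
        where
        b′ = suc a * (suc a * suc a) + t
        pairBound = (a + a * suc a) * (b′ + a * suc b′ + suc b′ * b′)
        identity : ∀ a t →
          (suc a * (suc a * suc a) + t + a * suc (suc a * (suc a * suc a) + t))
            * (suc a * (suc a * suc a) + t + a * suc (suc a * (suc a * suc a) + t))
          ≡ (a + a * suc a) * (suc a * (suc a * suc a) + t + a * suc (suc a * (suc a * suc a) + t)
                               + suc (suc a * (suc a * suc a) + t) * (suc a * (suc a * suc a) + t))
            + suc (2 * t + t * t + 4 * a + 4 * a * t + 6 * a * a + 4 * a * a * t
                   + 6 * a * a * a + a * a * a * t + 4 * a * a * a * a + a * a * a * a * a)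
        identity = solve-∀

  *+-injective : ∀ {m m′ n o o′} .{{_ : NonZero n}} → o < n → o′ < n
    → m * n + o ≡ m′ * n + o′ → m ≡ m′ × o ≡ o′
  *+-injective {m} {m′} {n} {o} {o′} o<n o′<n eq = *-cancelʳ-≡ m m′ n (+-cancelʳ-≡ o _ _ (trans eq (cong (m′ * n +_) (sym o≡o′)))) , o≡o′
    where
    mod-n : ∀ m o → o < n → (m * n + o) % n ≡ o
    mod-n m o o<n = trans (cong (_% n) (+-comm (m * n) o)) (trans ([m+kn]%n≡m%n o m n) (m<n⇒m%n≡m o<n))
    o≡o′ : o ≡ o′
    o≡o′ = trans (sym (mod-n m o o<n)) (trans (cong (_% n) eq) (mod-n m′ o′ o′<n))

  *+<* : ∀ {m l n o} → m < l → o < n → m * n + o < l * n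
  *+<* {m} {l} {n} {o} m<l o<n = <-≤-trans (+-monoʳ-< (m * n) o<n) (subst (_≤ l * n) (+-comm n (m * n)) (*-monoˡ-≤ n m<l))

module Congruence (p : ℕ) .{{_ : NonZero p}} where

  open import Data.Nat using (zero; suc)
  import Data.Nat.Properties as ℕ
  open import Data.Nat.DivMod using (_%_; _/_; m≡m%n+[m/n]*n; m%n<n)
  import Data.Nat.Divisibility as ℕ
  open import Data.Nat.Primality using (euclidsLemma)
  open import Data.Integer using (ℤ; +_; _+_; _*_; _-_; -_; ∣_∣)
  import Data.Integer.Properties as ℤ
  open import Data.Integer.Divisibility.Signed
    using (_∣_; divides; ∣m∣n⇒∣m+n; ∣m⇒∣m*n; ∣n⇒∣m*n; ∣m⇒∣-m; ∣⇒∣ᵤ; ∣ᵤ⇒∣)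
  open import Data.Integer.Tactic.RingSolver using (solve-∀)
  open import Data.Sum using (inj₁; inj₂)
  open import Relation.Nullary using (¬_; contradiction)
  open import Relation.Binary.Bundles using (Setoid)
  import Relation.Binary.Reasoning.Setoid
  open import Relation.Binary.Structures using (IsEquivalence)
  open import Relation.Binary.PropositionalEquality

  P : ℤ
  P = + p

  infix 4 _≋_
  record _≋_ (a b : ℤ) : Set where
    constructor mk≋
    field p∣a-b : P ∣ a - b
  open _≋_ public

  ≋-refl : ∀ {a} → a ≋ a
  ≋-refl {a} = mk≋ (subst (P ∣_) (sym (ℤ.+-inverseʳ a)) (divides (+ 0) refl))

  ≋-sym : ∀ {a b} → a ≋ b → b ≋ a
  ≋-sym {a} {b} (mk≋ h) = mk≋ (subst (P ∣_) (negate a b) (∣m⇒∣-m h))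
    where
    negate : ∀ a b → - (a - b) ≡ b - a
    negate = solve-∀

  ≋-trans : ∀ {a b c} → a ≋ b → b ≋ c → a ≋ c
  ≋-trans {a} {b} {c} (mk≋ h₁) (mk≋ h₂) = mk≋ (subst (P ∣_) (telescope a b c) (∣m∣n⇒∣m+n h₁ h₂))
    where
    telescope : ∀ a b c → (a - b) + (b - c) ≡ a - c
    telescope = solve-∀

  ≋-isEquivalence : IsEquivalence _≋_
  ≋-isEquivalence = record { refl = ≋-refl ; sym = ≋-sym ; trans = ≋-trans }

  ≋-setoid : Setoid _ _
  ≋-setoid = record { isEquivalence = ≋-isEquivalence }

  module ≋-Reasoning = Relation.Binary.Reasoning.Setoid ≋-setoid

  ≋-reflexive : ∀ {a b} → a ≡ b → a ≋ b
  ≋-reflexive refl = ≋-refl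

  +-cong : ∀ {a b c d} → a ≋ b → c ≋ d → a + c ≋ b + d
  +-cong {a} {b} {c} {d} (mk≋ h₁) (mk≋ h₂) = mk≋ (subst (P ∣_) (regroup a b c d) (∣m∣n⇒∣m+n h₁ h₂))
    where
    regroup : ∀ a b c d → (a - b) + (c - d) ≡ (a + c) - (b + d)
    regroup = solve-∀

  -‿cong : ∀ {a b} → a ≋ b → - a ≋ - b
  -‿cong {a} {b} (mk≋ h) = mk≋ (subst (P ∣_) (negate a b) (∣m⇒∣-m h))
    where
    negate : ∀ a b → - (a - b) ≡ - a - - b
    negate = solve-∀

  -‿congʳ : ∀ {a b c d} → a ≋ b → c ≋ d → a - c ≋ b - d
  -‿congʳ a≋b c≋d = +-cong a≋b (-‿cong c≋d)

  *-cong : ∀ {a b c d} → a ≋ b → c ≋ d → a * c ≋ b * d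
  *-cong {a} {b} {c} {d} (mk≋ h₁) (mk≋ h₂) = mk≋ (subst (P ∣_) (regroup a b c d) (∣m∣n⇒∣m+n (∣m⇒∣m*n c h₁) (∣n⇒∣m*n b h₂)))
    where
    regroup : ∀ a b c d → (a - b) * c + b * (c - d) ≡ a * c - b * d
    regroup = solve-∀

  *-congˡ : ∀ c {a b} → a ≋ b → c * a ≋ c * b
  *-congˡ c = *-cong (≋-refl {c})

  P≋0 : P ≋ + 0
  P≋0 = mk≋ (subst (P ∣_) (sym (ℤ.+-identityʳ P)) (divides (+ 1) (sym (ℤ.*-identityˡ P))))

  %-≋ : ∀ x → + (x % p) ≋ + x
  %-≋ x = mk≋ (divides (- + (x / p)) (begin
    + (x % p) - + x                               ≡⟨ cong (λ t → + (x % p) - + t) (m≡m%n+[m/n]*n x p) ⟩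
    + (x % p) - + (x % p ℕ.+ x / p ℕ.* p)          ≡⟨ cong (λ t → + (x % p) - t) (ℤ.pos-+ (x % p) _) ⟩
    + (x % p) - (+ (x % p) + + (x / p ℕ.* p))      ≡⟨ cong (λ t → + (x % p) - (+ (x % p) + t)) (ℤ.pos-* (x / p) p) ⟩
    + (x % p) - (+ (x % p) + + (x / p) * P)       ≡⟨ cancel (+ (x % p)) (+ (x / p)) P ⟩
    - + (x / p) * P                               ∎))
    where
    open ≡-Reasoning
    cancel : ∀ a b c → a - (a + b * c) ≡ - b * c
    cancel = solve-∀

  p∣d<p⇒d≡0 : ∀ {d} → d ℕ.< p → P ∣ + d → d ≡ 0
  p∣d<p⇒d≡0 {zero}  _   _   = refl
  p∣d<p⇒d≡0 {suc d} d<p p∣d = contradiction (ℕ.∣⇒≤ (∣⇒∣ᵤ p∣d)) (ℕ.<⇒≱ d<p)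

  ≤-residue-≋⇒≡ : ∀ {r s} → r ℕ.< p → s ℕ.≤ r → + r ≋ + s → r ≡ s
  ≤-residue-≋⇒≡ {r} {s} r<p s≤r (mk≋ h) = ℕ.≤-antisym (ℕ.m∸n≡0⇒m≤n r∸s≡0) s≤r
    where
    r∸s≡0 : r ℕ.∸ s ≡ 0
    r∸s≡0 = p∣d<p⇒d≡0 (ℕ.≤-<-trans (ℕ.m∸n≤m r s) r<p)
              (subst (P ∣_) (trans (ℤ.m-n≡m⊖n r s) (ℤ.⊖-≥ s≤r)) h)

  residue-≋⇒≡ : ∀ {r s} → r ℕ.< p → s ℕ.< p → + r ≋ + s → r ≡ s
  residue-≋⇒≡ {r} {s} r<p s<p r≋s with ℕ.≤-total s r
  ... | inj₁ s≤r = ≤-residue-≋⇒≡ r<p s≤r r≋s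
  ... | inj₂ r≤s = sym (≤-residue-≋⇒≡ s<p r≤s (≋-sym r≋s))

  ≋⇒%≡ : ∀ x y → + x ≋ + y → x % p ≡ y % p
  ≋⇒%≡ x y x≋y = residue-≋⇒≡ (m%n<n x p) (m%n<n y p) (≋-trans (%-≋ x) (≋-trans x≋y (≋-sym (%-≋ y))))

  %≡⇒≋ : ∀ x y → x % p ≡ y % p → + x ≋ + y
  %≡⇒≋ x y e = ≋-trans (≋-sym (%-≋ x)) (≋-trans (≋-reflexive (cong +_ e)) (%-≋ y))

  [a+[p∸u]]%p≋a-u : ∀ a u → u ℕ.≤ p → + ((a ℕ.+ (p ℕ.∸ u)) % p) ≋ + a - + u
  [a+[p∸u]]%p≋a-u a u u≤p = ≋-trans (%-≋ _) (≋-trans (≋-reflexive (ℤ.pos-+ a (p ℕ.∸ u))) (+-cong (≋-refl {+ a}) p∸u≋-u))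
    where
    p∸u≋-u : + (p ℕ.∸ u) ≋ - + u
    p∸u≋-u = ≋-trans (≋-reflexive (shift {+ u} (trans (sym (ℤ.pos-+ u (p ℕ.∸ u))) (cong +_ (ℕ.m+[n∸m]≡n u≤p)))))
                     (≋-trans (-‿congʳ P≋0 (≋-refl {+ u})) (≋-reflexive (ℤ.+-identityˡ (- + u))))
      where
      shift : ∀ {a b c} → a + b ≡ c → b ≡ c - a
      shift {a} {b} refl = cancel a b
        where
        cancel : ∀ a b → b ≡ (a + b) - a
        cancel = solve-∀

  eliminate : ∀ {u v w α β} → v ≋ α * u → w - v ≋ β * (w - u) → u * (β - α) ≋ w * (β - + 1)
  eliminate {u} {v} {w} {α} {β} v≋αu w-v≋β[w-u] = mk≋ (subst (P ∣_) (identity u v w α β) (p∣a-b (+-cong v≋αu w-v≋β[w-u])))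
    where
    identity : ∀ u v w α β → (v + (w - v)) - (α * u + β * (w - u)) ≡ u * (β - α) - w * (β - + 1)
    identity = solve-∀

  module _ (isPrime : Prime p) where

    p∣ab⇒p∣b : ∀ {a b} → ¬ (P ∣ a) → P ∣ a * b → P ∣ b
    p∣ab⇒p∣b {a} {b} p∤a p∣ab with euclidsLemma ∣ a ∣ ∣ b ∣ isPrime (subst (p ℕ.∣_) (ℤ.abs-* a b) (∣⇒∣ᵤ p∣ab))
    ... | inj₁ p∣a = contradiction (∣ᵤ⇒∣ p∣a) p∤a
    ... | inj₂ p∣b = ∣ᵤ⇒∣ p∣b

    *-cancelˡ-≋ : ∀ {a b c} → ¬ (P ∣ a) → a * b ≋ a * c → b ≋ c
    *-cancelˡ-≋ {a} {b} {c} p∤a (mk≋ h) = mk≋ (p∣ab⇒p∣b p∤a (subst (P ∣_) (factor a b c) h))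
      where
      factor : ∀ a b c → a * b - a * c ≡ a * (b - c)
      factor = solve-∀

module PrimitiveRootPowers (N g : ℕ) (isPrime : Prime (suc N)) (isPrimitive : PrimitiveRoot (suc N) g) where

  open import Data.Nat using (zero; _^_; z<s)
  import Data.Nat.Properties as ℕ
  open import Data.Nat.Tactic.RingSolver using (solve-∀)
  open import Data.Nat.DivMod using (_%_; m%n<n; m<n⇒m%n≡m)
  import Data.Nat.Divisibility as ℕ
  open import Data.Nat.Primality using (prime⇒nonTrivial)
  open import Data.Integer using (ℤ; +_; _*_)
  import Data.Integer.Properties as ℤ
  open import Data.Integer.Divisibility.Signed using (_∣_; ∣⇒∣ᵤ)
  open import Data.Product using (_×_; _,_; proj₁; proj₂)
  open import Data.Sum using (inj₁; inj₂)
  open import Function using (_∘_)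
  open import Relation.Nullary using (¬_; yes; no; contradiction)
  open import Relation.Binary.PropositionalEquality

  p : ℕ
  p = suc N

  open Congruence p
  open FiniteSums

  G : ℕ → ℤ
  G m = + (g ^ m)

  G-+ : ∀ a b → G (a ℕ.+ b) ≡ G a * G b
  G-+ a b = trans (cong +_ (ℕ.^-distribˡ-+-* g a b)) (ℤ.pos-* (g ^ a) (g ^ b))

  1<p : 1 ℕ.< p
  1<p = ℕ.nonTrivial⇒n>1 p {{prime⇒nonTrivial isPrime}}

  p∤G : ∀ m → ¬ (P ∣ G m)
  p∤G zero    p∣1  = ℕ.<⇒≱ 1<p (ℕ.∣⇒≤ (∣⇒∣ᵤ p∣1))
  p∤G (suc m) p∣gG = p∤G m (p∣ab⇒p∣b isPrime p∤g (subst (P ∣_) (ℤ.pos-* g (g ^ m)) p∣gG))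
    where
    p∤g : ¬ (P ∣ + g)
    p∤g p∣g = proj₁ isPrimitive (≋⇒%≡ g 0 (mk≋ (subst (P ∣_) (sym (ℤ.+-identityʳ (+ g))) p∣g)))

  G≋G⇒G≋1 : ∀ m d → G (m ℕ.+ d) ≋ G m → G d ≋ + 1
  G≋G⇒G≋1 m d h = *-cancelˡ-≋ isPrime (p∤G m)
    (≋-trans (≋-reflexive (sym (G-+ m d))) (≋-trans h (≋-reflexive (sym (ℤ.*-identityʳ (G m))))))

  G≉1 : ∀ {d} → 1 ℕ.≤ d → d ℕ.< N → ¬ (G d ≋ + 1)
  G≉1 {d} 1≤d d<N h = proj₂ isPrimitive d 1≤d d<N (trans (≋⇒%≡ (g ^ d) 1 h) (m<n⇒m%n≡m 1<p))

  ≤-G-injective : ∀ {m m′} → m ℕ.≤ m′ → m′ ℕ.< N → G m′ ≋ G m → m ≡ m′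
  ≤-G-injective {m} {m′} m≤m′ m′<N h with m′ ℕ.∸ m in d≡ | ℕ.m+[n∸m]≡n m≤m′
  ... | zero  | m+0≡m′ = trans (sym (ℕ.+-identityʳ m)) m+0≡m′
  ... | suc d | m+d≡m′ = contradiction (G≋G⇒G≋1 m (suc d) (subst (λ t → G t ≋ G m) (sym m+d≡m′) h))
                                       (G≉1 z<s (ℕ.≤-<-trans (ℕ.m≤n+m (suc d) m) (subst (ℕ._< N) (sym m+d≡m′) m′<N)))

  G-injective : ∀ {m m′} → m ℕ.< N → m′ ℕ.< N → G m ≋ G m′ → m ≡ m′
  G-injective {m} {m′} m<N m′<N h with ℕ.≤-total m m′
  ... | inj₁ m≤m′ = ≤-G-injective m≤m′ m′<N (≋-sym h)
  ... | inj₂ m′≤m = sym (≤-G-injective m′≤m m<N h)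

  residue : ℕ → ℕ
  residue m = (g ^ m) % p

  residue<p : ∀ m → residue m ℕ.< p
  residue<p m = m%n<n (g ^ m) p

  residue≢0 : ∀ m → residue m ≢ 0
  residue≢0 m r≡0 = p∤G m (subst (P ∣_) (ℤ.+-identityʳ (G m)) (p∣a-b (%≡⇒≋ (g ^ m) 0 r≡0)))

  residue-injective : ∀ {m m′} → m ℕ.< N → m′ ℕ.< N → residue m ≡ residue m′ → m ≡ m′
  residue-injective m<N m′<N r≡r′ = G-injective m<N m′<N (%≡⇒≋ _ _ r≡r′)

  occurrences : ℕ → ℕ
  occurrences x = ∑[ m < N ] δ (residue m) x

  occurrences≤1 : ∀ x → occurrences x ℕ.≤ 1
  occurrences≤1 x = ∑-≤1 N (λ m → δ (residue m) x) (λ m _ → δ≤1 (residue m) x)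
    (λ m m′ m<N m′<N δ>0 δ′>0 → residue-injective m<N m′<N (trans (δ>0⇒≡ δ>0) (sym (δ>0⇒≡ δ′>0))))

  ∑-occurrences : ∑[ x < p ] occurrences x ≡ N
  ∑-occurrences = begin
    ∑[ x < p ] ∑[ m < N ] δ (residue m) x  ≡⟨ ∑-comm p N _ ⟩
    ∑[ m < N ] ∑[ x < p ] δ (residue m) x  ≡⟨ ∑-cong N (λ m _ → trans (∑-cong p (λ x _ → δ-comm (residue m) x))
                                                                      (∑-δ p (residue m) (residue<p m))) ⟩
    ∑[ m < N ] 1                           ≡⟨ trans (∑-const N 1) (ℕ.*-identityʳ N) ⟩
    N                                      ∎
    where open ≡-Reasoning

  occurrences>0 : ∀ {x} → 0 ℕ.< x → x ℕ.< p → 0 ℕ.< occurrences x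
  occurrences>0 {x} 0<x x<p with occurrences x in occ≡
  ... | suc _ = z<s
  ... | zero  = contradiction (begin
    N ℕ.+ 2                                                   ≡⟨ cong (ℕ._+ 2) (sym ∑-occurrences) ⟩
    ∑[ y < p ] occurrences y ℕ.+ 2                            ≡⟨ sym (∑-avoiding-two p 0 x occurrences (ℕ.<-trans z<s 1<p) x<p) ⟩
    ∑[ y < p ] (occurrences y ℕ.+ (δ y 0 ℕ.+ δ y x))          ≤⟨ ∑-mono-≤ p (λ y _ → atMostOne y) ⟩
    ∑[ y < p ] 1                                              ≡⟨ trans (∑-const p 1) (ℕ.*-identityʳ p) ⟩
    p                                                         ∎) (ℕ.1+n≰n ∘ ℕ.≤-pred ∘ subst (ℕ._≤ p) (ℕ.+-comm N 2))
    where
    open ℕ.≤-Reasoning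
    occurrences0≡0 : occurrences 0 ≡ 0
    occurrences0≡0 = ∑-zero N (λ m _ → δ-≢ (residue≢0 m))
    atMostOne : ∀ y → occurrences y ℕ.+ (δ y 0 ℕ.+ δ y x) ℕ.≤ 1
    atMostOne y with y ℕ.≟ 0 | y ℕ.≟ x
    ... | yes refl | yes refl = contradiction 0<x (ℕ.<-irrefl refl)
    ... | yes refl | no _     rewrite occurrences0≡0 = ℕ.≤-refl
    ... | no _     | yes refl rewrite occ≡ = ℕ.≤-refl
    ... | no _     | no _     = subst (ℕ._≤ 1) (sym (ℕ.+-identityʳ _)) (occurrences≤1 y)

  -- The unique m < N with g^m ≡ x (mod p), written as a sum in which only that m survives.
  dlog : ℕ → ℕ
  dlog x = ∑[ m < N ] (δ (residue m) (x % p) ℕ.* m)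

  dlog-spec : ∀ x → x % p ≢ 0 → dlog x ℕ.< N × G (dlog x) ≋ + x
  dlog-spec x x≢0 = subst (ℕ._< N) (sym dlog≡m₀) m₀<N
                  , subst (λ m → G m ≋ + x) (sym dlog≡m₀) (%≡⇒≋ (g ^ m₀) x r[m₀]≡x)
    where
    x%p>0 : 0 ℕ.< x % p
    x%p>0 = ℕ.n≢0⇒n>0 x≢0
    found = ∑>0⇒∃ N (λ m → δ (residue m) (x % p)) (occurrences>0 x%p>0 (m%n<n x p))
    m₀ = proj₁ found
    m₀<N = proj₁ (proj₂ found)
    r[m₀]≡x : residue m₀ ≡ x % p
    r[m₀]≡x = δ>0⇒≡ (proj₂ (proj₂ found))
    δ≡δ : ∀ m → m ℕ.< N → δ (residue m) (x % p) ≡ δ m m₀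
    δ≡δ m m<N with residue m ℕ.≟ x % p | m ℕ.≟ m₀
    ... | yes _    | yes _    = refl
    ... | no _     | no _     = refl
    ... | yes r≡x  | no m≢m₀  = contradiction (residue-injective m<N m₀<N (trans r≡x (sym r[m₀]≡x))) m≢m₀
    ... | no r≢x   | yes refl = contradiction r[m₀]≡x r≢x
    dlog≡m₀ : dlog x ≡ m₀
    dlog≡m₀ = trans (∑-cong N (λ m m<N → cong (ℕ._* m) (δ≡δ m m<N))) (∑-δ-sift N m₀ (λ m → m) m₀<N)

  G[N]≋1 : G N ≋ + 1
  G[N]≋1 = viaLog (dlog-spec (g ^ N) (residue≢0 N))
    where
    viaLog : ∀ {m} → m ℕ.< N × G m ≋ G N → G N ≋ + 1
    viaLog {zero}  (_ , 1≋G[N])     = ≋-sym 1≋G[N]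
    viaLog {suc m} (m<N , G[m]≋G[N]) = contradiction (G≋G⇒G≋1 (suc m) d G[m+d]≋G[m]) (G≉1 (ℕ.m<n⇒0<n∸m m<N) d<N)
      where
      d = N ℕ.∸ suc m
      G[m+d]≋G[m] : G (suc m ℕ.+ d) ≋ G (suc m)
      G[m+d]≋G[m] = subst (λ t → G t ≋ G (suc m)) (sym (ℕ.m+[n∸m]≡n (ℕ.<⇒≤ m<N))) (≋-sym G[m]≋G[N])
      d<N : d ℕ.< N
      d<N = ℕ.∸-monoʳ-< z<s (ℕ.<⇒≤ m<N)

  G-periodic : ∀ m q → G (m ℕ.+ q ℕ.* N) ≋ G m
  G-periodic m zero    = ≋-reflexive (cong G (ℕ.+-identityʳ m))
  G-periodic m (suc q) = begin
    G (m ℕ.+ (N ℕ.+ q ℕ.* N))   ≡⟨ cong G (reorder m N (q ℕ.* N)) ⟩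
    G (m ℕ.+ q ℕ.* N ℕ.+ N)     ≡⟨ G-+ (m ℕ.+ q ℕ.* N) N ⟩
    G (m ℕ.+ q ℕ.* N) * G N     ≈⟨ *-congˡ (G (m ℕ.+ q ℕ.* N)) G[N]≋1 ⟩
    G (m ℕ.+ q ℕ.* N) * + 1     ≡⟨ ℤ.*-identityʳ _ ⟩
    G (m ℕ.+ q ℕ.* N)           ≈⟨ G-periodic m q ⟩
    G m                         ∎
    where
    open ≋-Reasoning
    reorder : ∀ a b c → a ℕ.+ (b ℕ.+ c) ≡ a ℕ.+ c ℕ.+ b
    reorder = solve-∀

module CyclotomicClasses (n k g : ℕ) .{{_ : NonZero n}} .{{_ : NonZero k}}
  (isPrime : Prime (suc (n ℕ.* k))) (isPrimitive : PrimitiveRoot (suc (n ℕ.* k)) g) where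

  open import Data.Nat using (_^_)
  import Data.Nat.Properties as ℕ
  open import Data.Nat.Tactic.RingSolver using (solve-∀)
  open import Data.Nat.DivMod using (_%_; _/_; m%n<n; m≡m%n+[m/n]*n; m<n*o⇒m/o<n)
  open import Data.Integer using (+_; _*_)
  open import Data.Product using (_,_; proj₁; proj₂)
  open import Relation.Binary.PropositionalEquality

  open PrimitiveRootPowers (n ℕ.* k) g isPrime isPrimitive public
  open Congruence p
  open FiniteSums

  N : ℕ
  N = n ℕ.* k

  class index : ℕ → ℕ
  class x = dlog x % n
  index x = dlog x / n

  class<n : ∀ x → class x ℕ.< n
  class<n x = m%n<n (dlog x) n

  index<k : ∀ {x} → x % p ≢ 0 → index x ℕ.< k
  index<k {x} x≢0 = m<n*o⇒m/o<n (subst (dlog x ℕ.<_) (ℕ.*-comm n k) (proj₁ (dlog-spec x x≢0)))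

  G[index*n+class]≋ : ∀ {x} → x % p ≢ 0 → G (index x ℕ.* n ℕ.+ class x) ≋ + x
  G[index*n+class]≋ {x} x≢0 = subst (λ m → G m ≋ + x) (divMod (dlog x)) (proj₂ (dlog-spec x x≢0))
    where
    divMod : ∀ m → m ≡ m / n ℕ.* n ℕ.+ m % n
    divMod m = trans (m≡m%n+[m/n]*n m n) (ℕ.+-comm (m % n) _)

  InX-class : ∀ {x} → x % p ≢ 0 → InX p n k g (class x) x
  InX-class {x} x≢0 = index x , index<k {x} x≢0 , sym (≋⇒%≡ (g ^ (index x ℕ.* n ℕ.+ class x)) x (G[index*n+class]≋ x≢0))

  InX-resp-≋ : ∀ {j a b} → InX p n k g j a → + a ≋ + b → InX p n k g j b
  InX-resp-≋ {b = b} (i , i<k , a≡) a≋b = i , i<k , trans (≋⇒%≡ b _ (≋-sym a≋b)) a≡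

  infixl 6 _⊖ₖ_
  _⊖ₖ_ : ℕ → ℕ → ℕ
  a′ ⊖ₖ a = (a′ ℕ.+ k ℕ.∸ a) % k

  ⊖ₖ<k : ∀ a′ a → a′ ⊖ₖ a ℕ.< k
  ⊖ₖ<k a′ a = m%n<n (a′ ℕ.+ k ℕ.∸ a) k

  ⊖ₖ-exponent : ∀ a a′ j → a ℕ.≤ k
    → (a′ ⊖ₖ a) ℕ.* n ℕ.+ (a ℕ.* n ℕ.+ j) ℕ.+ (a′ ℕ.+ k ℕ.∸ a) / k ℕ.* N ≡ a′ ℕ.* n ℕ.+ j ℕ.+ 1 ℕ.* N
  ⊖ₖ-exponent a a′ j a≤k = begin
    d % k ℕ.* n ℕ.+ (a ℕ.* n ℕ.+ j) ℕ.+ d / k ℕ.* N  ≡⟨ regroup n k (d % k) (d / k) a j ⟩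
    (d % k ℕ.+ d / k ℕ.* k ℕ.+ a) ℕ.* n ℕ.+ j         ≡⟨ cong (λ t → (t ℕ.+ a) ℕ.* n ℕ.+ j) (m≡m%n+[m/n]*n d k) ⟨
    (d ℕ.+ a) ℕ.* n ℕ.+ j                             ≡⟨ cong (λ t → t ℕ.* n ℕ.+ j) (ℕ.m∸n+n≡m (ℕ.≤-trans a≤k (ℕ.m≤n+m k a′))) ⟩
    (a′ ℕ.+ k) ℕ.* n ℕ.+ j                            ≡⟨ wrap n k a′ j ⟩
    a′ ℕ.* n ℕ.+ j ℕ.+ 1 ℕ.* N                        ∎
    where
    open ≡-Reasoning
    d = a′ ℕ.+ k ℕ.∸ a
    regroup : ∀ n k r q a j → r ℕ.* n ℕ.+ (a ℕ.* n ℕ.+ j) ℕ.+ q ℕ.* (n ℕ.* k) ≡ (r ℕ.+ q ℕ.* k ℕ.+ a) ℕ.* n ℕ.+ j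
    regroup = solve-∀
    wrap : ∀ n k a′ j → (a′ ℕ.+ k) ℕ.* n ℕ.+ j ≡ a′ ℕ.* n ℕ.+ j ℕ.+ 1 ℕ.* (n ℕ.* k)
    wrap = solve-∀

  G-shift : ∀ a a′ j → a ℕ.≤ k → G ((a′ ⊖ₖ a) ℕ.* n) * G (a ℕ.* n ℕ.+ j) ≋ G (a′ ℕ.* n ℕ.+ j)
  G-shift a a′ j a≤k = begin
    G ((a′ ⊖ₖ a) ℕ.* n) * G (a ℕ.* n ℕ.+ j)      ≡⟨ G-+ ((a′ ⊖ₖ a) ℕ.* n) (a ℕ.* n ℕ.+ j) ⟨
    G E                                           ≈⟨ G-periodic E q ⟨
    G (E ℕ.+ q ℕ.* N)                             ≡⟨ cong G (⊖ₖ-exponent a a′ j a≤k) ⟩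
    G (a′ ℕ.* n ℕ.+ j ℕ.+ 1 ℕ.* N)                ≈⟨ G-periodic (a′ ℕ.* n ℕ.+ j) 1 ⟩
    G (a′ ℕ.* n ℕ.+ j)                            ∎
    where
    open ≋-Reasoning
    q = (a′ ℕ.+ k ℕ.∸ a) / k
    E = (a′ ⊖ₖ a) ℕ.* n ℕ.+ (a ℕ.* n ℕ.+ j)

  sameClass⇒≋ : ∀ {x y} → x % p ≢ 0 → y % p ≢ 0 → class x ≡ class y
    → + y ≋ G ((index y ⊖ₖ index x) ℕ.* n) * + x
  sameClass⇒≋ {x} {y} x≢0 y≢0 cx≡cy = begin
    + y                                                           ≈⟨ G[index*n+class]≋ y≢0 ⟨
    G (index y ℕ.* n ℕ.+ class y)                                 ≡⟨ cong (λ c → G (index y ℕ.* n ℕ.+ c)) cx≡cy ⟨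
    G (index y ℕ.* n ℕ.+ class x)                                 ≈⟨ G-shift (index x) (index y) (class x) (ℕ.<⇒≤ (index<k {x} x≢0)) ⟨
    G ((index y ⊖ₖ index x) ℕ.* n) * G (index x ℕ.* n ℕ.+ class x)  ≈⟨ *-congˡ (G ((index y ⊖ₖ index x) ℕ.* n)) (G[index*n+class]≋ x≢0) ⟩
    G ((index y ⊖ₖ index x) ℕ.* n) * + x                          ∎
    where open ≋-Reasoning

  G[*n]-injective : ∀ {t t′} → t ℕ.< k → t′ ℕ.< k → G (t ℕ.* n) ≋ G (t′ ℕ.* n) → t ≡ t′
  G[*n]-injective {t} {t′} t<k t′<k h = ℕ.*-cancelʳ-≡ t t′ n (G-injective (*n<N t<k) (*n<N t′<k) h)
    where
    *n<N : ∀ {t} → t ℕ.< k → t ℕ.* n ℕ.< N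
    *n<N {t} t<k = subst (t ℕ.* n ℕ.<_) (ℕ.*-comm k n) (ℕ.*-monoˡ-< n t<k)

  InX-g^ : ∀ j → InX p n k g j (g ^ j)
  InX-g^ j = 0 , ℕ.>-nonZero⁻¹ k , refl

  InX⇒%≢0 : ∀ {j x} → InX p n k g j x → x % p ≢ 0
  InX⇒%≢0 {j} (i , _ , x≡) x≡0 = residue≢0 (i ℕ.* n ℕ.+ j) (trans (sym x≡) x≡0)

module DifferenceCells (n k g : ℕ) .{{_ : NonZero n}} .{{_ : NonZero k}}
  (isPrime : Prime (suc (n ℕ.* k))) (isPrimitive : PrimitiveRoot (suc (n ℕ.* k)) g)
  (w : ℕ) (w<p : w ℕ.< suc (n ℕ.* k)) (w≢0 : w ≢ 0) where

  open import Data.Nat using (zero; suc; _^_; z<s)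
  import Data.Nat.Properties as ℕ
  import Data.Nat.Tactic.RingSolver as NatSolver
  open import Data.Nat.DivMod using (_%_; m<n⇒m%n≡m)
  open import Data.Integer using (ℤ; +_; _+_; _*_; _-_)
  import Data.Integer.Properties as ℤ
  open import Data.Integer.Divisibility.Signed using (_∣_)
  open import Data.Integer.Tactic.RingSolver using (solve-∀)
  open import Data.Product using (∃-syntax; _×_; _,_; proj₁; proj₂)
  open import Function using (_∘_)
  open import Relation.Nullary using (¬_; Dec; yes; no; contradiction)
  open import Relation.Nullary.Decidable using (¬?; _×-dec_)
  open import Relation.Binary.PropositionalEquality

  open CyclotomicClasses n k g isPrime isPrimitive
  open Congruence p
  open FiniteSums
  open Arithmetic using (*+-injective; *+<*; square-exceeds-pair-bound)

  complement : ℕ → ℕ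
  complement u = (w ℕ.+ (p ℕ.∸ u)) % p

  complement-≋ : ∀ {u} → u ℕ.< p → + complement u ≋ + w - + u
  complement-≋ {u} u<p = [a+[p∸u]]%p≋a-u w u (ℕ.<⇒≤ u<p)

  %≢0 : ∀ {u} → u ℕ.< p → u ≢ 0 → u % p ≢ 0
  %≢0 u<p u≢0 = u≢0 ∘ trans (sym (m<n⇒m%n≡m u<p))

  complement≢0 : ∀ {u} → u ℕ.< p → u ≢ w → complement u % p ≢ 0
  complement≢0 {u} u<p u≢w c≡0 = u≢w (sym (residue-≋⇒≡ w<p u<p w≋u))
    where
    w≋u : + w ≋ + u
    w≋u = begin
      + w                         ≡⟨ shift (+ w) (+ u) ⟩
      + w - + u + + u             ≈⟨ +-cong (complement-≋ u<p) (≋-refl {+ u}) ⟨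
      + complement u + + u        ≈⟨ +-cong (%≡⇒≋ (complement u) 0 c≡0) (≋-refl {+ u}) ⟩
      + 0 + + u                   ≡⟨ ℤ.+-identityˡ (+ u) ⟩
      + u                         ∎
      where
      open ≋-Reasoning
      shift : ∀ a b → a ≡ a - b + b
      shift = solve-∀

  Admissible : ℕ → Set
  Admissible u = u ≢ 0 × u ≢ w

  admissible? : ∀ u → Dec (Admissible u)
  admissible? u = ¬? (u ℕ.≟ 0) ×-dec ¬? (u ℕ.≟ w)

  admissible : ℕ → ℕ
  admissible u = 𝕀 (admissible? u)

  admissible>0⇒ : ∀ {u} → 0 ℕ.< admissible u → Admissible u
  admissible>0⇒ {u} = 𝕀>0⇒ (admissible? u)

  M : ℕ
  M = ∑[ u < p ] admissible u

  M+2≡p : M ℕ.+ 2 ≡ p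
  M+2≡p = begin
    M ℕ.+ 2                                           ≡⟨ ∑-avoiding-two p 0 w admissible z<s w<p ⟨
    ∑[ u < p ] (admissible u ℕ.+ (δ u 0 ℕ.+ δ u w))   ≡⟨ ∑-cong p (λ u _ → partition u) ⟩
    ∑[ u < p ] 1                                      ≡⟨ trans (∑-const p 1) (ℕ.*-identityʳ p) ⟩
    p                                                 ∎
    where
    open ≡-Reasoning
    partition : ∀ u → admissible u ℕ.+ (δ u 0 ℕ.+ δ u w) ≡ 1
    partition u with u ℕ.≟ 0 | u ℕ.≟ w
    ... | yes refl | yes refl = contradiction refl w≢0
    ... | yes refl | no _     = refl
    ... | no _     | yes refl = refl
    ... | no _     | no _     = refl

  cell : ℕ → ℕ
  cell u = class u ℕ.* n ℕ.+ class (complement u)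

  cell<n² : ∀ u → cell u ℕ.< n ℕ.* n
  cell<n² u = *+<* (class<n u) (class<n (complement u))

  cellSize : ℕ → ℕ
  cellSize c = ∑[ u < p ] (admissible u ℕ.* δ (cell u) c)

  ∑-cellSize : ∑[ c < n ℕ.* n ] cellSize c ≡ M
  ∑-cellSize = begin
    ∑[ c < n ℕ.* n ] ∑[ u < p ] (admissible u ℕ.* δ (cell u) c)   ≡⟨ ∑-comm (n ℕ.* n) p _ ⟩
    ∑[ u < p ] ∑[ c < n ℕ.* n ] (admissible u ℕ.* δ (cell u) c)   ≡⟨ ∑-cong p (λ u _ → sym (*-distribˡ-∑ (n ℕ.* n) (admissible u) (δ (cell u)))) ⟩
    ∑[ u < p ] (admissible u ℕ.* ∑[ c < n ℕ.* n ] δ (cell u) c)   ≡⟨ ∑-cong p (λ u _ → cong (admissible u ℕ.*_) (oneCell u)) ⟩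
    ∑[ u < p ] (admissible u ℕ.* 1)                              ≡⟨ ∑-cong p (λ u _ → ℕ.*-identityʳ (admissible u)) ⟩
    M                                                            ∎
    where
    open ≡-Reasoning
    oneCell : ∀ u → ∑[ c < n ℕ.* n ] δ (cell u) c ≡ 1
    oneCell u = trans (∑-cong (n ℕ.* n) (λ c _ → δ-comm (cell u) c)) (∑-δ (n ℕ.* n) (cell u) (cell<n² u))

  sameCell : ℕ → ℕ → ℕ
  sameCell u v = admissible u ℕ.* admissible v ℕ.* δ (cell u) (cell v)

  ∑-cellSize² : ∑[ c < n ℕ.* n ] (cellSize c ℕ.* cellSize c) ≡ ∑[ u < p ] ∑[ v < p ] sameCell u v
  ∑-cellSize² = begin
    ∑[ c < n ℕ.* n ] (cellSize c ℕ.* cellSize c)          ≡⟨ ∑-cong (n ℕ.* n) (λ c _ → ∑*∑ p p _ _) ⟩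
    ∑[ c < n ℕ.* n ] ∑[ u < p ] ∑[ v < p ] F c u v        ≡⟨ ∑-comm (n ℕ.* n) p _ ⟩
    ∑[ u < p ] ∑[ c < n ℕ.* n ] ∑[ v < p ] F c u v        ≡⟨ ∑-cong p (λ u _ → ∑-comm (n ℕ.* n) p _) ⟩
    ∑[ u < p ] ∑[ v < p ] ∑[ c < n ℕ.* n ] F c u v        ≡⟨ ∑-cong p (λ u _ → ∑-cong p (λ v _ → sift u v)) ⟩
    ∑[ u < p ] ∑[ v < p ] sameCell u v                    ∎
    where
    open ≡-Reasoning
    F : ℕ → ℕ → ℕ → ℕ
    F c u v = admissible u ℕ.* δ (cell u) c ℕ.* (admissible v ℕ.* δ (cell v) c)
    sift : ∀ u v → ∑[ c < n ℕ.* n ] F c u v ≡ sameCell u v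
    sift u v = begin
      ∑[ c < n ℕ.* n ] F c u v                                         ≡⟨ ∑-cong (n ℕ.* n) (λ c _ → regroup c) ⟩
      ∑[ c < n ℕ.* n ] (δ c (cell u) ℕ.* (admissible u ℕ.* admissible v ℕ.* δ (cell v) c))
                                                                       ≡⟨ ∑-δ-sift (n ℕ.* n) (cell u) _ (cell<n² u) ⟩
      admissible u ℕ.* admissible v ℕ.* δ (cell v) (cell u)            ≡⟨ cong (admissible u ℕ.* admissible v ℕ.*_) (δ-comm (cell v) (cell u)) ⟩
      sameCell u v                                                     ∎
      where
      regroup : ∀ c → F c u v ≡ δ c (cell u) ℕ.* (admissible u ℕ.* admissible v ℕ.* δ (cell v) c)
      regroup c = trans (rearrange (admissible u) (δ (cell u) c) (admissible v) (δ (cell v) c))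
                        (cong (ℕ._* (admissible u ℕ.* admissible v ℕ.* δ (cell v) c)) (δ-comm (cell u) c))
        where
        rearrange : ∀ a d b e → a ℕ.* d ℕ.* (b ℕ.* e) ≡ d ℕ.* (a ℕ.* b ℕ.* e)
        rearrange = NatSolver.solve-∀

  distinctSameCell : ℕ → ℕ → ℕ
  distinctSameCell u v = sameCell u v ℕ.* 𝕀 (¬? (u ℕ.≟ v))

  record DistinctSameCell (u v : ℕ) : Set where
    field
      u<p          : u ℕ.< p
      v<p          : v ℕ.< p
      u≢v          : u ≢ v
      admissible-u : Admissible u
      admissible-v : Admissible v
      class≡       : class u ≡ class v
      classᶜ≡      : class (complement u) ≡ class (complement v)

  distinctSameCell>0⇒ : ∀ {u v} → u ℕ.< p → v ℕ.< p → 0 ℕ.< distinctSameCell u v → DistinctSameCell u v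
  distinctSameCell>0⇒ {u} {v} u<p v<p d>0
    with m*n>0⇒m>0×n>0 (sameCell u v) _ d>0
  ... | s>0 , u≢v>0 with m*n>0⇒m>0×n>0 (admissible u ℕ.* admissible v) _ s>0
  ... | a>0 , δ>0 with m*n>0⇒m>0×n>0 (admissible u) (admissible v) a>0
  ... | au>0 , av>0 = record
    { u<p = u<p ; v<p = v<p ; u≢v = 𝕀>0⇒ (¬? (u ℕ.≟ v)) u≢v>0
    ; admissible-u = admissible>0⇒ au>0 ; admissible-v = admissible>0⇒ av>0
    ; class≡ = proj₁ classes ; classᶜ≡ = proj₂ classes }
    where
    classes = *+-injective (class<n (complement u)) (class<n (complement v)) (δ>0⇒≡ δ>0)

  distinctSameCell≤1 : ∀ u v → distinctSameCell u v ℕ.≤ 1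
  distinctSameCell≤1 u v =
    ℕ.*-mono-≤ (ℕ.*-mono-≤ (ℕ.*-mono-≤ (𝕀≤1 (admissible? u)) (𝕀≤1 (admissible? v))) (δ≤1 (cell u) (cell v)))
               (𝕀≤1 (¬? (u ℕ.≟ v)))

  p∤w : ¬ (P ∣ + w)
  p∤w p∣w = w≢0 (p∣d<p⇒d≡0 w<p p∣w)

  -- For distinct u, v in one cell, v = α u and w - v = β (w - u) with α = g^(τ n), β = g^(σ n).
  τ σ : ℕ → ℕ → ℕ
  τ u v = index v ⊖ₖ index u
  σ u v = index (complement v) ⊖ₖ index (complement u)

  τ<k : ∀ u v → τ u v ℕ.< k
  τ<k u v = ⊖ₖ<k (index v) (index u)

  σ<k : ∀ u v → σ u v ℕ.< k
  σ<k u v = ⊖ₖ<k (index (complement v)) (index (complement u))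

  α β : ℕ → ℕ → ℤ
  α u v = G (τ u v ℕ.* n)
  β u v = G (σ u v ℕ.* n)

  module _ {u v : ℕ} (pair : DistinctSameCell u v) where
    open DistinctSameCell pair

    v≋αu : + v ≋ α u v * + u
    v≋αu = sameClass⇒≋ (%≢0 u<p (proj₁ admissible-u)) (%≢0 v<p (proj₁ admissible-v)) class≡

    w-v≋β[w-u] : + w - + v ≋ β u v * (+ w - + u)
    w-v≋β[w-u] = begin
      + w - + v                    ≈⟨ complement-≋ v<p ⟨
      + complement v               ≈⟨ sameClass⇒≋ (complement≢0 u<p (proj₂ admissible-u)) (complement≢0 v<p (proj₂ admissible-v)) classᶜ≡ ⟩
      β u v * + complement u       ≈⟨ *-congˡ (β u v) (complement-≋ u<p) ⟩
      β u v * (+ w - + u)          ∎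
      where open ≋-Reasoning

    u[β-α]≋w[β-1] : + u * (β u v - α u v) ≋ + w * (β u v - + 1)
    u[β-α]≋w[β-1] = eliminate {+ u} {+ v} {+ w} {α u v} {β u v} v≋αu w-v≋β[w-u]

    τ≢σ : τ u v ≢ σ u v
    τ≢σ τ≡σ = u≢v (sym (residue-≋⇒≡ v<p u<p v≋u))
      where
      open ≋-Reasoning
      β≋1 : β u v ≋ + 1
      β≋1 = *-cancelˡ-≋ isPrime p∤w (begin
        + w * β u v                              ≡⟨ split (+ w) (β u v) ⟩
        + w * (β u v - + 1) + + w * + 1          ≈⟨ +-cong u[β-α]≋w[β-1] (≋-refl {+ w * + 1}) ⟨
        + u * (β u v - α u v) + + w * + 1        ≡⟨ cong (λ t → + u * (β u v - G (t ℕ.* n)) + + w * + 1) τ≡σ ⟩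
        + u * (β u v - β u v) + + w * + 1        ≡⟨ vanish (+ u) (β u v) (+ w * + 1) ⟩
        + w * + 1                                ∎)
        where
        split : ∀ w b → w * b ≡ w * (b - + 1) + w * + 1
        split = solve-∀
        vanish : ∀ u b c → u * (b - b) + c ≡ c
        vanish = solve-∀
      v≋u : + v ≋ + u
      v≋u = begin
        + v              ≈⟨ v≋αu ⟩
        α u v * + u      ≡⟨ cong (λ t → G (t ℕ.* n) * + u) τ≡σ ⟩
        β u v * + u      ≈⟨ *-cong β≋1 (≋-refl {+ u}) ⟩
        + 1 * + u        ≡⟨ ℤ.*-identityˡ (+ u) ⟩
        + u              ∎

    p∤β-α : ¬ (P ∣ β u v - α u v)
    p∤β-α p∣β-α = τ≢σ (sym (G[*n]-injective (σ<k u v) (τ<k u v) (mk≋ p∣β-α)))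

  distinctSameCell-injective : ∀ {u v u′ v′} → DistinctSameCell u v → DistinctSameCell u′ v′
    → τ u v ≡ τ u′ v′ → σ u v ≡ σ u′ v′ → u ≡ u′ × v ≡ v′
  distinctSameCell-injective {u} {v} {u′} {v′} pair pair′ τ≡ σ≡ = u≡u′ , v≡v′
    where
    open ≋-Reasoning
    open DistinctSameCell
    α≡ : α u′ v′ ≡ α u v
    α≡ = cong (λ t → G (t ℕ.* n)) (sym τ≡)
    β≡ : β u′ v′ ≡ β u v
    β≡ = cong (λ t → G (t ℕ.* n)) (sym σ≡)
    u≋u′ : + u ≋ + u′
    u≋u′ = *-cancelˡ-≋ isPrime (p∤β-α pair) (begin
      (β u v - α u v) * + u          ≡⟨ ℤ.*-comm _ (+ u) ⟩
      + u * (β u v - α u v)          ≈⟨ u[β-α]≋w[β-1] pair ⟩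
      + w * (β u v - + 1)            ≡⟨ cong (λ b → + w * (b - + 1)) β≡ ⟨
      + w * (β u′ v′ - + 1)          ≈⟨ u[β-α]≋w[β-1] pair′ ⟨
      + u′ * (β u′ v′ - α u′ v′)     ≡⟨ cong₂ (λ b a → + u′ * (b - a)) β≡ α≡ ⟩
      + u′ * (β u v - α u v)         ≡⟨ ℤ.*-comm (+ u′) _ ⟩
      (β u v - α u v) * + u′         ∎)
    u≡u′ : u ≡ u′
    u≡u′ = residue-≋⇒≡ (u<p pair) (u<p pair′) u≋u′
    v≡v′ : v ≡ v′
    v≡v′ = residue-≋⇒≡ (v<p pair) (v<p pair′) (begin
      + v                ≈⟨ v≋αu pair ⟩
      α u v * + u        ≡⟨ cong (λ t → α u v * + t) u≡u′ ⟩
      α u v * + u′       ≡⟨ cong (_* + u′) α≡ ⟨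
      α u′ v′ * + u′     ≈⟨ v≋αu pair′ ⟨
      + v′               ∎)

  ∑-distinctSameCell≤ : ∑[ u < p ] ∑[ v < p ] distinctSameCell u v ℕ.≤ k ℕ.* (k ℕ.∸ 1)
  ∑-distinctSameCell≤ = ∑∑-offDiagonal-injection-≤ p p k distinctSameCell τ σ τ<k σ<k
    (λ u v _ _ → distinctSameCell≤1 u v)
    (λ u v u<p v<p d>0 → τ≢σ (distinctSameCell>0⇒ u<p v<p d>0))
    (λ u v u′ v′ u<p v<p u′<p v′<p d>0 d′>0 →
      distinctSameCell-injective (distinctSameCell>0⇒ u<p v<p d>0) (distinctSameCell>0⇒ u′<p v′<p d′>0))

  sameCell≤ : ∀ u v → sameCell u v ℕ.≤ admissible u ℕ.* δ v u ℕ.+ distinctSameCell u v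
  sameCell≤ u v with u ℕ.≟ v
  ... | yes refl = ℕ.≤-trans diagonal (ℕ.m≤m+n _ _)
    where
    open ℕ.≤-Reasoning
    diagonal : sameCell u u ℕ.≤ admissible u ℕ.* δ u u
    diagonal = begin
      admissible u ℕ.* admissible u ℕ.* δ (cell u) (cell u)  ≡⟨ cong (admissible u ℕ.* admissible u ℕ.*_) (δ-refl (cell u)) ⟩
      admissible u ℕ.* admissible u ℕ.* 1                   ≡⟨ ℕ.*-identityʳ _ ⟩
      admissible u ℕ.* admissible u                         ≤⟨ ℕ.*-monoʳ-≤ (admissible u) (𝕀≤1 (admissible? u)) ⟩
      admissible u ℕ.* 1                                    ≡⟨ cong (admissible u ℕ.*_) (δ-refl u) ⟨
      admissible u ℕ.* δ u u                                ∎
  ... | no _ = ℕ.≤-trans (ℕ.≤-reflexive (sym (ℕ.*-identityʳ (sameCell u v)))) (ℕ.m≤n+m _ _)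

  ∑-sameCell≤ : ∑[ u < p ] ∑[ v < p ] sameCell u v ℕ.≤ M ℕ.+ k ℕ.* (k ℕ.∸ 1)
  ∑-sameCell≤ = begin
    ∑[ u < p ] ∑[ v < p ] sameCell u v                                        ≤⟨ ∑-mono-≤ p (λ u _ → ∑-mono-≤ p (λ v _ → sameCell≤ u v)) ⟩
    ∑[ u < p ] ∑[ v < p ] (admissible u ℕ.* δ v u ℕ.+ distinctSameCell u v)   ≡⟨ ∑-cong p (λ u _ → ∑-distrib-+ p _ _) ⟩
    ∑[ u < p ] (∑[ v < p ] (admissible u ℕ.* δ v u) ℕ.+ ∑[ v < p ] distinctSameCell u v)
                                                                              ≡⟨ ∑-distrib-+ p _ _ ⟩
    ∑[ u < p ] ∑[ v < p ] (admissible u ℕ.* δ v u) ℕ.+ ∑[ u < p ] ∑[ v < p ] distinctSameCell u v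
                                                                              ≡⟨ cong (ℕ._+ ∑[ u < p ] ∑[ v < p ] distinctSameCell u v) (∑-cong p diagonal) ⟩
    M ℕ.+ ∑[ u < p ] ∑[ v < p ] distinctSameCell u v                          ≤⟨ ℕ.+-monoʳ-≤ M ∑-distinctSameCell≤ ⟩
    M ℕ.+ k ℕ.* (k ℕ.∸ 1)                                                     ∎
    where
    open ℕ.≤-Reasoning
    diagonal : ∀ u → u ℕ.< p → ∑[ v < p ] (admissible u ℕ.* δ v u) ≡ admissible u
    diagonal u u<p = trans (sym (*-distribˡ-∑ p (admissible u) (λ v → δ v u)))
                           (trans (cong (admissible u ℕ.*_) (∑-δ p u u<p)) (ℕ.*-identityʳ _))

  cellSize>0 : n ^ 4 ℕ.+ 5 ℕ.< p → ∀ {c} → c ℕ.< n ℕ.* n → 0 ℕ.< cellSize c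
  cellSize>0 big {c} c<n² with cellSize c in size≡
  ... | suc _ = z<s
  ... | zero  = contradiction cauchySchwarz
                  (ℕ.<⇒≱ (square-exceeds-pair-bound n k M Z M+2≡p (|supp|<m (n ℕ.* n) cellSize c c<n² size≡) big))
    where
    Z = ∑[ c < n ℕ.* n ] sgn (cellSize c)
    open ℕ.≤-Reasoning
    cauchySchwarz : M ℕ.* M ℕ.≤ Z ℕ.* (M ℕ.+ k ℕ.* (k ℕ.∸ 1))
    cauchySchwarz = begin
      M ℕ.* M                                                     ≡⟨ cong₂ ℕ._*_ ∑-cellSize ∑-cellSize ⟨
      ∑[ c < n ℕ.* n ] cellSize c ℕ.* ∑[ c < n ℕ.* n ] cellSize c  ≤⟨ cauchy-schwarz (n ℕ.* n) cellSize ⟩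
      Z ℕ.* ∑[ c < n ℕ.* n ] (cellSize c ℕ.* cellSize c)           ≡⟨ cong (Z ℕ.*_) ∑-cellSize² ⟩
      Z ℕ.* ∑[ u < p ] ∑[ v < p ] sameCell u v                     ≤⟨ ℕ.*-monoʳ-≤ Z ∑-sameCell≤ ⟩
      Z ℕ.* (M ℕ.+ k ℕ.* (k ℕ.∸ 1))                                ∎

  split-into-classes : n ^ 4 ℕ.+ 5 ℕ.< p → ∀ {b c} → b ℕ.< n → c ℕ.< n
    → ∃[ u ] (u ℕ.< p × InX p n k g b u × InX p n k g c (complement u))
  split-into-classes big {b} {c} b<n c<n
    with ∑>0⇒∃ p (λ u → admissible u ℕ.* δ (cell u) (b ℕ.* n ℕ.+ c)) (cellSize>0 big (*+<* b<n c<n))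
  ... | u , u<p , u>0 with m*n>0⇒m>0×n>0 (admissible u) _ u>0
  ...   | a>0 , δ>0 with admissible>0⇒ a>0 | *+-injective {class u} {b} (class<n (complement u)) c<n (δ>0⇒≡ δ>0)
  ...     | u≢0 , u≢w | cu≡b , cū≡c =
    u , u<p , subst (λ i → InX p n k g i u) cu≡b (InX-class {u} (%≢0 u<p u≢0))
            , subst (λ i → InX p n k g i (complement u)) cū≡c (InX-class {complement u} (complement≢0 u<p u≢w))

module CyclotomicFlexibility (n k g : ℕ) .{{_ : NonZero n}} .{{_ : NonZero k}}
  (isPrime : Prime (suc (n ℕ.* k))) (isPrimitive : PrimitiveRoot (suc (n ℕ.* k)) g)
  (big : n ℕ.^ 4 ℕ.+ 5 ℕ.< suc (n ℕ.* k)) where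

  open import Data.Nat using (_^_)
  import Data.Nat.Properties as ℕ
  open import Data.Nat.DivMod using (_%_; m%n<n; m<n⇒m%n≡m)
  open import Data.Integer using (+_; _+_; _-_)
  import Data.Integer.Properties as ℤ
  open import Data.Integer.Tactic.RingSolver using (solve-∀)
  open import Data.Fin using (Fin; toℕ)
  open import Data.Fin.Properties using (toℕ<n)
  open import Data.Product using (∃-syntax; _×_; _,_)
  open import Relation.Binary.PropositionalEquality

  open CyclotomicClasses n k g isPrime isPrimitive
  open Congruence p

  sums-meet-every-class : (i j l : Fin n) → ∃[ x ] ∃[ y ] (InX p n k g (toℕ i) x × InX p n k g (toℕ j) y
                                                         × InX p n k g (toℕ l) ((x ℕ.+ y) % p))
  sums-meet-every-class i j l = fromSplit (split-into-classes big (toℕ<n i) (toℕ<n j))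
    where
    open DifferenceCells n k g isPrime isPrimitive (residue (toℕ l)) (residue<p (toℕ l)) (residue≢0 (toℕ l))
    fromSplit : ∃[ u ] (u ℕ.< p × InX p n k g (toℕ i) u × InX p n k g (toℕ j) (complement u))
              → ∃[ x ] ∃[ y ] (InX p n k g (toℕ i) x × InX p n k g (toℕ j) y × InX p n k g (toℕ l) ((x ℕ.+ y) % p))
    fromSplit (u , u<p , u∈Xi , w-u∈Xj) = u , complement u , u∈Xi , w-u∈Xj , InX-resp-≋ (InX-g^ (toℕ l)) (≋-sym sum≋w)
      where
      open ≋-Reasoning
      sum≋w : + ((u ℕ.+ complement u) % p) ≋ + (g ^ toℕ l)
      sum≋w = begin
        + ((u ℕ.+ complement u) % p)          ≈⟨ %-≋ (u ℕ.+ complement u) ⟩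
        + (u ℕ.+ complement u)                ≡⟨ ℤ.pos-+ u (complement u) ⟩
        + u + + complement u                  ≈⟨ +-cong (≋-refl {+ u}) (complement-≋ u<p) ⟩
        + u + (+ residue (toℕ l) - + u)       ≡⟨ cancel (+ u) (+ residue (toℕ l)) ⟩
        + residue (toℕ l)                     ≈⟨ %-≋ (g ^ toℕ l) ⟩
        + (g ^ toℕ l)                         ∎
        where
        cancel : ∀ a b → a + (b - a) ≡ b
        cancel = solve-∀

  flexible : (a : Fin n) → Flexible p n k g a
  flexible a b c x z (x<p , z<p , w∈Xa) = fromSplit (split-into-classes big (toℕ<n b) (toℕ<n c))
    where
    w = (x ℕ.+ (p ℕ.∸ z)) % p
    w<p : w ℕ.< p
    w<p = m%n<n (x ℕ.+ (p ℕ.∸ z)) p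
    w≢0 : w ≢ 0
    w≢0 w≡0 = InX⇒%≢0 {x = w} w∈Xa (trans (m<n⇒m%n≡m w<p) w≡0)
    open DifferenceCells n k g isPrime isPrimitive w w<p w≢0
    fromSplit : ∃[ u ] (u ℕ.< p × InX p n k g (toℕ b) u × InX p n k g (toℕ c) (complement u))
              → ∃[ y ] (Atom p n k g b x y × Atom p n k g c y z)
    fromSplit (u , u<p , u∈Xb , w-u∈Xc) =
      y , (x<p , y<p , InX-resp-≋ u∈Xb (≋-sym x-y≋u)) , (y<p , z<p , InX-resp-≋ w-u∈Xc (≋-sym y-z≋w-u))
      where
      open ≋-Reasoning
      y = (x ℕ.+ (p ℕ.∸ u)) % p
      y<p : y ℕ.< p
      y<p = m%n<n (x ℕ.+ (p ℕ.∸ u)) p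
      y≋x-u : + y ≋ + x - + u
      y≋x-u = [a+[p∸u]]%p≋a-u x u (ℕ.<⇒≤ u<p)
      x-y≋u : + ((x ℕ.+ (p ℕ.∸ y)) % p) ≋ + u
      x-y≋u = begin
        + ((x ℕ.+ (p ℕ.∸ y)) % p)   ≈⟨ [a+[p∸u]]%p≋a-u x y (ℕ.<⇒≤ y<p) ⟩
        + x - + y                   ≈⟨ -‿congʳ (≋-refl {+ x}) y≋x-u ⟩
        + x - (+ x - + u)           ≡⟨ cancel (+ x) (+ u) ⟩
        + u                         ∎
        where
        cancel : ∀ a b → a - (a - b) ≡ b
        cancel = solve-∀
      y-z≋w-u : + ((y ℕ.+ (p ℕ.∸ z)) % p) ≋ + complement u
      y-z≋w-u = begin
        + ((y ℕ.+ (p ℕ.∸ z)) % p)   ≈⟨ [a+[p∸u]]%p≋a-u y z (ℕ.<⇒≤ z<p) ⟩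
        + y - + z                   ≈⟨ -‿congʳ y≋x-u (≋-refl {+ z}) ⟩
        + x - + u - + z             ≡⟨ swap (+ x) (+ u) (+ z) ⟩
        + x - + z - + u             ≈⟨ -‿congʳ ([a+[p∸u]]%p≋a-u x z (ℕ.<⇒≤ z<p)) (≋-refl {+ u}) ⟨
        + w - + u                   ≈⟨ complement-≋ u<p ⟨
        + complement u              ∎
        where
        swap : ∀ a b c → a - b - c ≡ a - c - b
        swap = solve-∀

open import Data.Nat using (_+_; _*_; _^_; _≤_; _<_; >-nonZero)
open import Data.Nat.DivMod using (_%_)
open import Data.Nat.Divisibility using (_∣_)
open import Data.Fin using (Fin; toℕ)
open import Data.Product using (∃-syntax; _×_; _,_)

lemma10 : (n k : ℕ) → 1 ≤ n → 1 ≤ k → 2 ∣ k → Prime (suc (n * k))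
    → n ^ 4 + 5 < suc (n * k)
    → (g : ℕ) → PrimitiveRoot (suc (n * k)) g
    → ((a : Fin n) → Flexible (suc (n * k)) n k g a)
      × ((i j l : Fin n) → ∃[ x ] ∃[ y ] (InX (suc (n * k)) n k g (toℕ i) x
           × InX (suc (n * k)) n k g (toℕ j) y
           × InX (suc (n * k)) n k g (toℕ l) ((x + y) % suc (n * k))))
lemma10 n k 1≤n 1≤k _ isPrime big g isPrimitive = flexible , sums-meet-every-class
  where
  instance
    n≢0 : NonZero n
    n≢0 = >-nonZero 1≤n
    k≢0 : NonZero k
    k≢0 = >-nonZero 1≤k
  open CyclotomicFlexibility n k g isPrime isPrimitive big
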